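{- Let $C$ be a generalized cocharge tableau of shape $\lambda\vdash n$. Then $C=\operatorname{ct}(S)$ for some $S\in\operatorname{SYT}(\lambda)$ if and only if the following holds: for every $h>0$ occurring in $C$, if $v$ is the leftmost box of $C$ containing $h$, then some box of $C$ lying in a row strictly above the row of $v$ contains $h-1$. In particular, in that case every nonzero value occurring in $C$ also occurs outside the first row of $C$.
   Context: $\mathbb{N}_m=\{1,\dots,m\}$. Tableaux are in English notation; $\operatorname{SYT}(\lambda)$ is the set of standard Young tableaux of shape $\lambda$ with entries $\mathbb{N}_n$. For $S\in\operatorname{SYT}(\lambda)$ with $R_S(i),C_S(i)$ the row and column of $i$, $\operatorname{Dsi}(S)$ is the set of $i\in\mathbb{N}_{n-1}$ with $R_S(i+1)>R_S(i)$ and $C_S(i+1)\le C_S(i)$, and $\operatorname{ct}(S)$ is obtained from $S$ by replacing each entry $p$ by $|\{j\in\operatorname{Dsi}(S): j<p\}|$. A generalized cocharge tableau of shape $\lambda$ is a semistandard filling of $\lambda$ (rows weakly increasing, columns strictly increasing) by nonnegative integers whose set of values is exactly $\{0,1,\dots,k-1\}$ for some $k$. -}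

module Defs where

open import Data.Nat using (ℕ; zero; suc; _+_; _∸_; _≤_; _<_; _≤ᵇ_; _<ᵇ_; _≡ᵇ_)
open import Data.Bool using (Bool; true; false; _∧_)
open import Data.Nat.ListAction using (sum)
open import Data.List using (List; []; _∷_; length; map; upTo; _++_; filterᵇ)
open import Data.Maybe using (Maybe; just; nothing)
open import Data.Product using (Σ; _×_; _,_; ∃; ∃-syntax)
open import Relation.Binary.PropositionalEquality using (_≡_)

rowLen : List ℕ → ℕ → ℕ
rowLen []       _       = 0
rowLen (l ∷ _)  zero    = l
rowLen (_ ∷ ls) (suc r) = rowLen ls r

data Decreasing : List ℕ → Set where
  []  : Decreasing []
  [_] : ∀ l → Decreasing (l ∷ [])
  _∷_ : ∀ {l m ls} → m ≤ l → Decreasing (m ∷ ls) → Decreasing (l ∷ m ∷ ls)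

data AllPositive : List ℕ → Set where
  []  : AllPositive []
  _∷_ : ∀ {l ls} → 0 < l → AllPositive ls → AllPositive (l ∷ ls)

_⊢_ : List ℕ → ℕ → Set
λs ⊢ n = Decreasing λs × AllPositive λs × sum λs ≡ n

-- Box (r , c) (0-indexed row r, column c; English notation) lies in λ.
InShape : List ℕ → ℕ → ℕ → Set
InShape λs r c = c < rowLen λs r

-- A filling of a shape: values at boxes outside the shape are irrelevant.
Filling : Set
Filling = ℕ → ℕ → ℕ

record IsSYT (λs : List ℕ) (n : ℕ) (S : Filling) : Set where
  field
    entry-range : ∀ r c → InShape λs r c → 1 ≤ S r c × S r c ≤ n
    injective   : ∀ r c r' c' → InShape λs r c → InShape λs r' c' →
                  S r c ≡ S r' c' → (r ≡ r') × (c ≡ c')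
    surjective  : ∀ p → 1 ≤ p → p ≤ n → ∃[ r ] ∃[ c ] (InShape λs r c × S r c ≡ p)
    rows-incr   : ∀ r c → InShape λs r (suc c) → S r c < S r (suc c)
    cols-incr   : ∀ r c → InShape λs (suc r) c → S r c < S (suc r) c

cellsFrom : ℕ → List ℕ → List (ℕ × ℕ)
cellsFrom r []       = []
cellsFrom r (l ∷ ls) = map (r ,_) (upTo l) ++ cellsFrom (suc r) ls

cells : List ℕ → List (ℕ × ℕ)
cells = cellsFrom 0

findIn : Filling → ℕ → List (ℕ × ℕ) → Maybe (ℕ × ℕ)
findIn S i []              = nothing
findIn S i ((r , c) ∷ xs) with S r c ≡ᵇ i
... | true  = just (r , c)
... | false = findIn S i xs

pos : List ℕ → Filling → ℕ → Maybe (ℕ × ℕ)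
pos λs S i = findIn S i (cells λs)

isDsi : List ℕ → Filling → ℕ → Bool
isDsi λs S i with pos λs S i | pos λs S (suc i)
... | just (r , c) | just (r' , c') = (r <ᵇ r') ∧ (c' ≤ᵇ c)
... | _            | _              = false

-- ct(S): replace each entry p by |{ j ∈ Dsi(S) : j < p }|
-- (j ranges over 1,…,p-1 ⊆ ℕ_{n-1} since p ≤ n)
ct : List ℕ → Filling → Filling
ct λs S r c = length (filterᵇ (isDsi λs S) (map suc (upTo (S r c ∸ 1))))

record IsGenCocharge (λs : List ℕ) (C : Filling) : Set where
  field
    rows-weak   : ∀ r c → InShape λs r (suc c) → C r c ≤ C r (suc c)
    cols-strict : ∀ r c → InShape λs (suc r) c → C r c < C (suc r) c
    values      : ∃[ k ] ((∀ r c → InShape λs r c → C r c < k) ×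
                          (∀ h → h < k → ∃[ r ] ∃[ c ] (InShape λs r c × C r c ≡ h)))

_≐[_]_ : Filling → List ℕ → Filling → Set
C ≐[ λs ] D = ∀ r c → InShape λs r c → C r c ≡ D r c

LeftmostCondition : List ℕ → Filling → Set
LeftmostCondition λs C =
  ∀ h r c → 0 < h → InShape λs r c → C r c ≡ h →
  (∀ r' c' → InShape λs r' c' → C r' c' ≡ h → c ≤ c') →
  ∃[ r'' ] ∃[ c'' ] (r'' < r × InShape λs r'' c'' × C r'' c'' ≡ h ∸ 1)

NonzeroOffFirstRow : List ℕ → Filling → Set
NonzeroOffFirstRow λs C =
  ∀ h r c → 0 < h → InShape λs r c → C r c ≡ h →
  ∃[ r' ] ∃[ c' ] (1 ≤ r' × InShape λs r' c' × C r' c' ≡ h)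

module Submission where

-- ct(S) stays constant from the box of i to the box of i + 1, except at a descent i,
-- where it increases by one.
--
-- If v is the leftmost box of ct(S) containing h > 0, let v' be the box of S(v) - 1.
-- Were S(v) - 1 not a descent, v' would also contain h, so it would lie weakly right of
-- v, and (as S(v') < S(v)) strictly above it: a descent after all. So S(v) - 1 is a
-- descent, and v' contains h - 1 in a higher row than v.
--
-- Conversely, number the boxes of C by increasing entry, ties broken from left to
-- right; this gives a standard tableau S. Equal entries of C form a horizontal strip,
-- so a tie is never a descent of S. When the entry increases, it increases by one
-- (every value up to the maximum occurs), the new box is the leftmost of its value and
-- the old one the rightmost of its value, and the condition then forces a descent.
-- Hence ct(S) = C.

open import Defs
open import Data.Nat
  using (ℕ; zero; suc; _+_; _*_; _∸_; _≤_; _<_; _≥_; _≡ᵇ_; z≤n; s≤s; _≟_; _<?_; _≤?_)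
open import Data.Nat.Properties
open import Data.Nat.Induction using (<-rec)
open import Data.Nat.ListAction using (sum)
open import Data.Bool using (Bool; true; false; T; T?)
open import Data.Unit using (tt)
open import Data.List using (List; []; _∷_; length; map; upTo; _++_; filterᵇ)
open import Data.List.Properties
  using (length-++; length-map; length-upTo; upTo-∷ʳ; map-++; filter-++; filter-accept; filter-reject)
open import Data.List.Membership.Propositional using (_∈_)
open import Data.List.Membership.Propositional.Properties
  using (∈-map⁺; ∈-map⁻; ∈-++⁺ˡ; ∈-++⁺ʳ; ∈-++⁻; ∈-upTo⁺; ∈-upTo⁻)
open import Data.List.Relation.Unary.Any using (here; there)
import Data.List.Relation.Unary.All as All
import Data.List.Relation.Unary.All.Properties as All
open import Data.List.Relation.Unary.Unique.Propositional using (Unique; []; _∷_)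
import Data.List.Relation.Unary.Unique.Propositional.Properties as Unique
open import Data.Maybe using (just)
open import Data.Product using (_×_; _,_; ∃-syntax; proj₁; proj₂; uncurry)
open import Data.Sum using (_⊎_; inj₁; inj₂)
open import Data.Empty using (⊥; ⊥-elim)
open import Function using (_∘_; flip)
open import Relation.Binary using (Rel; Transitive; Reflexive)
open import Relation.Binary.Definitions using (tri<; tri≈; tri>)
open import Relation.Nullary using (¬_; Dec; yes; no; does; contradiction)
open import Relation.Nullary.Decidable using (_×-dec_; dec-true; dec-false)
open import Relation.Unary using (Pred; Decidable)
open import Relation.Binary.PropositionalEquality
  using (_≡_; refl; sym; trans; cong; cong₂; subst; module ≡-Reasoning)

private
  variable
    ls : List ℕ
    r r' c c' : ℕ

-- Shapes and fillings

module _ {ℓ} (_∼_ : Rel ℕ ℓ) (∼-trans : Transitive _∼_) (f : ℕ → ℕ) where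

  step-chain : ∀ {i j} → (∀ {k} → suc k ≤ j → f k ∼ f (suc k)) → i < j → f i ∼ f j
  step-chain {i} {suc j} step (s≤s i≤j) with m≤n⇒m<n∨m≡n i≤j
  ... | inj₂ refl = step {j} ≤-refl
  ... | inj₁ i<j  = ∼-trans (step-chain (λ {k} → step {k} ∘ m≤n⇒m≤1+n) i<j) (step {j} ≤-refl)

  step-chain-≤ : Reflexive _∼_ → ∀ {i j} →
                 (∀ {k} → suc k ≤ j → f k ∼ f (suc k)) → i ≤ j → f i ∼ f j
  step-chain-≤ ∼-refl step i≤j with m≤n⇒m<n∨m≡n i≤j
  ... | inj₂ refl = ∼-refl
  ... | inj₁ i<j  = step-chain step i<j

rowLen-suc : Decreasing ls → ∀ r → rowLen ls (suc r) ≤ rowLen ls r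
rowLen-suc []          r       = z≤n
rowLen-suc [ l ]       r       = z≤n
rowLen-suc (m≤l ∷ dec) zero    = m≤l
rowLen-suc (m≤l ∷ dec) (suc r) = rowLen-suc dec r

InShape-up : Decreasing ls → r ≤ r' → InShape ls r' c → InShape ls r c
InShape-up {ls} dec r≤r' s =
  <-≤-trans s (step-chain-≤ _≥_ (flip ≤-trans) (rowLen ls) ≤-refl
                            (λ {k} _ → rowLen-suc dec k) r≤r')

rowLen≤sum : ∀ ls r → rowLen ls r ≤ sum ls
rowLen≤sum []       r       = z≤n
rowLen≤sum (l ∷ ls) zero    = m≤m+n l (sum ls)
rowLen≤sum (l ∷ ls) (suc r) = ≤-trans (rowLen≤sum ls r) (m≤n+m (sum ls) l)

InShape⇒row<length : ∀ ls r → InShape ls r c → r < length ls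
InShape⇒row<length (l ∷ ls) zero    s = s≤s z≤n
InShape⇒row<length (l ∷ ls) (suc r) s = s≤s (InShape⇒row<length ls r s)

InShape? : ∀ ls r c → Dec (InShape ls r c)
InShape? ls r c = c <? rowLen ls r

∈-cellsFrom⁻ : ∀ r₀ ls → (r , c) ∈ cellsFrom r₀ ls → ∃[ d ] (r ≡ d + r₀ × InShape ls d c)
∈-cellsFrom⁻ r₀ (l ∷ ls) m with ∈-++⁻ (map (r₀ ,_) (upTo l)) m
... | inj₁ m₁ with ∈-map⁻ (r₀ ,_) m₁
...   | c , c∈ , refl = 0 , refl , ∈-upTo⁻ c∈
∈-cellsFrom⁻ r₀ (l ∷ ls) m | inj₂ m₂ with ∈-cellsFrom⁻ (suc r₀) ls m₂
... | d , refl , s = suc d , +-suc d r₀ , s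

∈-cellsFrom⁺ : ∀ r₀ ls d → InShape ls d c → (d + r₀ , c) ∈ cellsFrom r₀ ls
∈-cellsFrom⁺     r₀ (l ∷ ls) zero    s = ∈-++⁺ˡ (∈-map⁺ (r₀ ,_) (∈-upTo⁺ s))
∈-cellsFrom⁺ {c} r₀ (l ∷ ls) (suc d) s = ∈-++⁺ʳ (map (r₀ ,_) (upTo l))
  (subst (λ r → (r , c) ∈ cellsFrom (suc r₀) ls) (+-suc d r₀) (∈-cellsFrom⁺ (suc r₀) ls d s))

∈-cells⁻ : ∀ ls → (r , c) ∈ cells ls → InShape ls r c
∈-cells⁻ ls m with ∈-cellsFrom⁻ 0 ls m
... | d , refl , s = subst (λ r → InShape ls r _) (sym (+-identityʳ d)) s

∈-cells⁺ : ∀ ls → InShape ls r c → (r , c) ∈ cells ls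
∈-cells⁺ {r} {c} ls s =
  subst (λ r → (r , c) ∈ cells ls) (+-identityʳ r) (∈-cellsFrom⁺ 0 ls r s)

length-cellsFrom : ∀ r₀ ls → length (cellsFrom r₀ ls) ≡ sum ls
length-cellsFrom r₀ []       = refl
length-cellsFrom r₀ (l ∷ ls) = begin
  length (row ++ cellsFrom (suc r₀) ls)      ≡⟨ length-++ row ⟩
  length row + length (cellsFrom (suc r₀) ls) ≡⟨ cong₂ _+_ length-row (length-cellsFrom (suc r₀) ls) ⟩
  l + sum ls                                  ∎
  where
  open ≡-Reasoning
  row = map (r₀ ,_) (upTo l)
  length-row = trans (length-map (r₀ ,_) (upTo l)) (length-upTo l)

cellsFrom-unique : ∀ r₀ ls → Unique (cellsFrom r₀ ls)
cellsFrom-unique r₀ []       = []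
cellsFrom-unique r₀ (l ∷ ls) =
  Unique.++⁺ (Unique.map⁺ (cong proj₂) (Unique.upTo⁺ l)) (cellsFrom-unique (suc r₀) ls) disjoint
  where
  disjoint : ∀ {v} → v ∈ map (r₀ ,_) (upTo l) × v ∈ cellsFrom (suc r₀) ls → ⊥
  disjoint (m , m') with ∈-map⁻ (r₀ ,_) m | ∈-cellsFrom⁻ (suc r₀) ls m'
  ... | _ , _ , refl | d , r₀≡ , _ = m≢1+n+m r₀ (trans r₀≡ (+-suc d r₀))

module _ {ls} (dec : Decreasing ls) (F : Filling) where

  row-< : (∀ r c → InShape ls r (suc c) → F r c < F r (suc c)) →
          c < c' → InShape ls r c' → F r c < F r c'
  row-< {r = r} step c<c' s =
    step-chain _<_ <-trans (F r) (λ {k} k<c' → step r k (≤-<-trans k<c' s)) c<c'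

  row-≤ : (∀ r c → InShape ls r (suc c) → F r c ≤ F r (suc c)) →
          c ≤ c' → InShape ls r c' → F r c ≤ F r c'
  row-≤ {r = r} step c≤c' s =
    step-chain-≤ _≤_ ≤-trans (F r) ≤-refl (λ {k} k<c' → step r k (≤-<-trans k<c' s)) c≤c'

  col-< : (∀ r c → InShape ls (suc r) c → F r c < F (suc r) c) →
          r < r' → InShape ls r' c → F r c < F r' c
  col-< {c = c} step r<r' s =
    step-chain _<_ <-trans (λ r → F r c) (λ {k} k<r' → step k c (InShape-up dec k<r' s)) r<r'

  col-≤ : (∀ r c → InShape ls (suc r) c → F r c ≤ F (suc r) c) →
          r ≤ r' → InShape ls r' c → F r c ≤ F r' c
  col-≤ {c = c} step r≤r' s =
    step-chain-≤ _≤_ ≤-trans (λ r → F r c) ≤-refl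
                 (λ {k} k<r' → step k c (InShape-up dec k<r' s)) r≤r'

horizontal-strip : ∀ {ls C} → Decreasing ls → IsGenCocharge ls C → InShape ls r' c' →
                   C r c ≡ C r' c' → c ≤ c' → r' ≤ r
horizontal-strip {ls = ls} {C} dec G s' same c≤c' = ≮⇒≥ λ r<r' →
  <-irrefl same (≤-<-trans (row-≤ dec C rows-weak c≤c' (InShape-up dec (<⇒≤ r<r') s'))
                           (col-< dec C cols-strict r<r' s'))
  where open IsGenCocharge G

IsLeast : ∀ {p} → Pred ℕ p → ℕ → Set p
IsLeast P m = P m × ∀ {k} → P k → m ≤ k

least-witness : ∀ {p} {P : Pred ℕ p} → Decidable P → ∀ {n} → P n → ∃[ m ] IsLeast P m
least-witness {P = P} P? {n} = <-rec (λ n → P n → ∃[ m ] IsLeast P m) search n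
  where
  search : ∀ n → (∀ {k} → k < n → P k → ∃[ m ] IsLeast P m) → P n → ∃[ m ] IsLeast P m
  search n below Pn with anyUpTo? P? n
  ... | yes (k , k<n , Pk) = below k<n Pk
  ... | no none            = n , Pn , λ Pk → ≮⇒≥ λ k<n → none (_ , k<n , Pk)

-- The bound on r, implied by InShape, makes the predicate decidable.
ColumnContains : List ℕ → Filling → ℕ → ℕ → Set
ColumnContains ls C h c = ∃[ r ] (r < length ls × InShape ls r c × C r c ≡ h)

columnContains? : ∀ ls C h → Decidable (ColumnContains ls C h)
columnContains? ls C h c = anyUpTo? (λ r → InShape? ls r c ×-dec C r c ≟ h) (length ls)

leftmost-occurrence : ∀ ls {h} (C : Filling) → InShape ls r c → C r c ≡ h →
  ∃[ r₀ ] ∃[ c₀ ] (InShape ls r₀ c₀ × C r₀ c₀ ≡ h ×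
                   (∀ r' c' → InShape ls r' c' → C r' c' ≡ h → c₀ ≤ c'))
leftmost-occurrence {r} ls C s e
  with least-witness (columnContains? ls C _) (r , InShape⇒row<length ls r s , s , e)
... | c₀ , (r₀ , _ , s₀ , e₀) , least =
  r₀ , c₀ , s₀ , e₀ , λ r' c' s' e' → least (r' , InShape⇒row<length ls r' s' , s' , e')

leftmost⇒nonzero-off-first-row : ∀ {ls C} → LeftmostCondition ls C → NonzeroOffFirstRow ls C
leftmost⇒nonzero-off-first-row {ls} {C} L h r c 0<h s e with leftmost-occurrence ls C s e
... | r₀ , c₀ , s₀ , e₀ , leftmost with L h r₀ c₀ 0<h s₀ e₀ leftmost
... | _ , _ , r<r₀ , _ = r₀ , c₀ , ≤-trans (s≤s z≤n) r<r₀ , s₀ , e₀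

leftmost-cong : ∀ {ls C D} → C ≐[ ls ] D → LeftmostCondition ls D → LeftmostCondition ls C
leftmost-cong C≐D L h r c 0<h s e leftmost
  with L h r c 0<h s (trans (sym (C≐D r c s)) e)
         (λ r' c' s' e' → leftmost r' c' s' (trans (C≐D r' c' s') e'))
... | r'' , c'' , r''<r , s'' , e'' = r'' , c'' , r''<r , s'' , trans (C≐D r'' c'' s'') e''

-- Descents and the map ct

countTo : (ℕ → Bool) → ℕ → ℕ
countTo p m = length (filterᵇ p (map suc (upTo m)))

countTo-suc : ∀ p m → countTo p (suc m) ≡ countTo p m + length (filterᵇ p (suc m ∷ []))
countTo-suc p m = begin
  length (filterᵇ p (map suc (upTo (suc m))))
    ≡⟨ cong (λ xs → length (filterᵇ p (map suc xs))) (sym (upTo-∷ʳ m)) ⟩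
  length (filterᵇ p (map suc (upTo m ++ (m ∷ []))))
    ≡⟨ cong (length ∘ filterᵇ p) (map-++ suc (upTo m) (m ∷ [])) ⟩
  length (filterᵇ p (map suc (upTo m) ++ (suc m ∷ [])))
    ≡⟨ cong length (filter-++ (T? ∘ p) (map suc (upTo m)) (suc m ∷ [])) ⟩
  length (filterᵇ p (map suc (upTo m)) ++ filterᵇ p (suc m ∷ []))
    ≡⟨ length-++ (filterᵇ p (map suc (upTo m))) ⟩
  countTo p m + length (filterᵇ p (suc m ∷ [])) ∎
  where open ≡-Reasoning

countTo-suc-true : ∀ p m → p (suc m) ≡ true → countTo p (suc m) ≡ suc (countTo p m)
countTo-suc-true p m p≡true = begin
  countTo p (suc m)                             ≡⟨ countTo-suc p m ⟩
  countTo p m + length (filterᵇ p (suc m ∷ [])) ≡⟨ cong (λ xs → countTo p m + length xs) accept ⟩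
  countTo p m + 1                               ≡⟨ +-comm (countTo p m) 1 ⟩
  suc (countTo p m)                             ∎
  where
  open ≡-Reasoning
  accept = filter-accept (T? ∘ p) (subst T (sym p≡true) tt)

countTo-suc-false : ∀ p m → p (suc m) ≡ false → countTo p (suc m) ≡ countTo p m
countTo-suc-false p m p≡false = begin
  countTo p (suc m)                             ≡⟨ countTo-suc p m ⟩
  countTo p m + length (filterᵇ p (suc m ∷ [])) ≡⟨ cong (λ xs → countTo p m + length xs) reject ⟩
  countTo p m + 0                               ≡⟨ +-identityʳ (countTo p m) ⟩
  countTo p m                                   ∎
  where
  open ≡-Reasoning
  reject = filter-reject (T? ∘ p) (subst T p≡false)

ct-at : ∀ ls {i} (S : Filling) → S r c ≡ suc i → ct ls S r c ≡ countTo (isDsi ls S) i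
ct-at ls S e = cong (λ a → countTo (isDsi ls S) (a ∸ 1)) e

findIn-unique : ∀ S i xs → (r , c) ∈ xs → S r c ≡ i →
                (∀ {r' c'} → (r' , c') ∈ xs → S r' c' ≡ i → (r' , c') ≡ (r , c)) →
                findIn S i xs ≡ just (r , c)
findIn-unique S i ((r' , c') ∷ xs) m e unique with S r' c' ≡ᵇ i in eq
... | true = cong just (unique (here refl) (≡ᵇ⇒≡ (S r' c') i (subst T (sym eq) tt)))
... | false with m
...   | here refl = ⊥-elim (subst T eq (≡⇒≡ᵇ (S r' c') i e))
...   | there m'  = findIn-unique S i xs m' e (λ m'' → unique (there m''))

Descent : ℕ × ℕ → ℕ × ℕ → Set
Descent (r' , c') (r , c) = r' < r × c ≤ c'

descent? : ∀ u v → Dec (Descent u v)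
descent? (r' , c') (r , c) = r' <? r ×-dec c ≤? c'

module _ {ls n S} (syt : IsSYT ls n S) where
  open IsSYT syt

  pos-entry : InShape ls r c → pos ls S (S r c) ≡ just (r , c)
  pos-entry s = findIn-unique S _ (cells ls) (∈-cells⁺ ls s) refl λ {r'} {c'} m e →
    let r'≡r , c'≡c = injective r' c' _ _ (∈-cells⁻ ls m) s e in cong₂ _,_ r'≡r c'≡c

  isDsi-entries : InShape ls r' c' → InShape ls r c → S r c ≡ suc (S r' c') →
                  isDsi ls S (S r' c') ≡ does (descent? (r' , c') (r , c))
  isDsi-entries s' s next
    rewrite pos-entry s' | subst (λ a → pos ls S a ≡ just _) next (pos-entry s) = refl

  entry-pred : InShape ls r c → ∃[ m ] (S r c ≡ suc m)
  entry-pred {r} {c} s with S r c | proj₁ (entry-range r c s)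
  ... | suc m | _ = m , refl

  ct-step-descent : InShape ls r' c' → InShape ls r c → S r c ≡ suc (S r' c') →
                    Descent (r' , c') (r , c) → ct ls S r c ≡ suc (ct ls S r' c')
  ct-step-descent {r'} {c'} {r} {c} s' s next d with entry-pred s'
  ... | m , S'≡ = begin
    ct ls S r c         ≡⟨ ct-at ls S (trans next (cong suc S'≡)) ⟩
    countTo p (suc m)   ≡⟨ countTo-suc-true p m (trans (cong p (sym S'≡)) isDsi≡true) ⟩
    suc (countTo p m)   ≡⟨ cong suc (sym (ct-at ls S S'≡)) ⟩
    suc (ct ls S r' c') ∎
    where
    open ≡-Reasoning
    p = isDsi ls S
    isDsi≡true = trans (isDsi-entries s' s next) (dec-true (descent? _ _) d)

  ct-step-ascent : InShape ls r' c' → InShape ls r c → S r c ≡ suc (S r' c') →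
                   ¬ Descent (r' , c') (r , c) → ct ls S r c ≡ ct ls S r' c'
  ct-step-ascent {r'} {c'} {r} {c} s' s next ¬d with entry-pred s'
  ... | m , S'≡ = begin
    ct ls S r c       ≡⟨ ct-at ls S (trans next (cong suc S'≡)) ⟩
    countTo p (suc m) ≡⟨ countTo-suc-false p m (trans (cong p (sym S'≡)) isDsi≡false) ⟩
    countTo p m       ≡⟨ sym (ct-at ls S S'≡) ⟩
    ct ls S r' c'     ∎
    where
    open ≡-Reasoning
    p = isDsi ls S
    isDsi≡false = trans (isDsi-entries s' s next) (dec-false (descent? _ _) ¬d)

  predecessor : InShape ls r c →
                S r c ≡ 1 ⊎ ∃[ r' ] ∃[ c' ] (InShape ls r' c' × S r c ≡ suc (S r' c'))
  predecessor {r} {c} s with entry-pred s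
  ... | zero  , S≡1 = inj₁ S≡1
  ... | suc m , S≡
    with surjective (suc m) (s≤s z≤n)
                    (≤-trans (n≤1+n _) (subst (_≤ n) S≡ (proj₂ (entry-range r c s))))
  ...   | r' , c' , s' , S'≡ = inj₂ (r' , c' , s' , trans S≡ (cong suc (sym S'≡)))

  entry-monotone : Decreasing ls → r ≤ r' → c ≤ c' → InShape ls r' c' →
                   S r c ≤ S r' c'
  entry-monotone dec r≤r' c≤c' s = ≤-trans
    (col-≤ dec S (λ r c s → <⇒≤ (cols-incr r c s)) r≤r' (≤-<-trans c≤c' s))
    (row-≤ dec S (λ r c s → <⇒≤ (rows-incr r c s)) c≤c' s)

  ct-leftmost : Decreasing ls → LeftmostCondition ls (ct ls S)
  ct-leftmost dec h r c 0<h s ct≡h leftmost with predecessor s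
  ... | inj₁ S≡1 = contradiction (trans (sym ct≡h) (ct-at ls S S≡1)) (>⇒≢ 0<h)
  ... | inj₂ (r' , c' , s' , next) with descent? (r' , c') (r , c)
  ...   | yes d@(r'<r , _) =
    r' , c' , r'<r , s' , cong (_∸ 1) (trans (sym (ct-step-descent s' s next d)) ct≡h)
  ...   | no ¬d = contradiction (r'<r , c≤c') ¬d
    where
    c≤c' = leftmost r' c' s' (trans (sym (ct-step-ascent s' s next ¬d)) ct≡h)
    r'<r = ≰⇒> λ r≤r' →
      n≮n (S r' c') (subst (_≤ S r' c') next (entry-monotone dec r≤r' c≤c' s'))

-- Ranks in a list of distinct numbers

Unique-map⁺-on : ∀ {A B : Set} {f : A → B} {xs : List A} →
                 (∀ {x y} → x ∈ xs → y ∈ xs → f x ≡ f y → x ≡ y) →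
                 Unique xs → Unique (map f xs)
Unique-map⁺-on inj []         = []
Unique-map⁺-on inj (x∉ ∷ xs!) =
  All.map⁺ (All.tabulate λ y∈ fx≡fy → All.lookup x∉ y∈ (inj (here refl) (there y∈) fx≡fy)) ∷
  Unique-map⁺-on (λ x∈ y∈ → inj (there x∈) (there y∈)) xs!

countBelow : ℕ → List ℕ → ℕ
countBelow v []       = 0
countBelow v (u ∷ us) with u <? v
... | yes _ = suc (countBelow v us)
... | no _  = countBelow v us

module _ {u v : ℕ} {us : List ℕ} where

  countBelow-∷-< : u < v → countBelow v (u ∷ us) ≡ suc (countBelow v us)
  countBelow-∷-< u<v with u <? v
  ... | yes _  = refl
  ... | no u≮v = contradiction u<v u≮v

  countBelow-∷-≮ : ¬ u < v → countBelow v (u ∷ us) ≡ countBelow v us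
  countBelow-∷-≮ u≮v with u <? v
  ... | yes u<v = contradiction u<v u≮v
  ... | no _    = refl

countBelow≤length : ∀ v us → countBelow v us ≤ length us
countBelow≤length v []       = z≤n
countBelow≤length v (u ∷ us) with u <? v
... | yes _ = s≤s (countBelow≤length v us)
... | no _  = m≤n⇒m≤1+n (countBelow≤length v us)

countBelow-mono : ∀ {v w} → v ≤ w → ∀ us → countBelow v us ≤ countBelow w us
countBelow-mono v≤w []       = z≤n
countBelow-mono {v} {w} v≤w (u ∷ us) with u <? v | u <? w
... | yes _   | yes _  = s≤s (countBelow-mono v≤w us)
... | yes u<v | no u≮w = contradiction (<-≤-trans u<v v≤w) u≮w
... | no _    | yes _  = m≤n⇒m≤1+n (countBelow-mono v≤w us)
... | no _    | no _   = countBelow-mono v≤w us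

countBelow-<-length : ∀ {v us} → v ∈ us → countBelow v us < length us
countBelow-<-length {v} {v ∷ us} (here refl) rewrite countBelow-∷-≮ {us = us} (n≮n v) =
  s≤s (countBelow≤length v us)
countBelow-<-length {v} {u ∷ us} (there v∈) with u <? v
... | yes _ = s≤s (countBelow-<-length v∈)
... | no _  = m<n⇒m<1+n (countBelow-<-length v∈)

countBelow-strict : ∀ {v w us} → v ∈ us → v < w → countBelow v us < countBelow w us
countBelow-strict {v} {w} {v ∷ us} (here refl) v<w
  rewrite countBelow-∷-≮ {us = us} (n≮n v) | countBelow-∷-< {us = us} v<w =
  s≤s (countBelow-mono (<⇒≤ v<w) us)
countBelow-strict {v} {w} {u ∷ us} (there v∈) v<w with u <? v | u <? w
... | yes _   | yes _  = s≤s (countBelow-strict v∈ v<w)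
... | yes u<v | no u≮w = contradiction (<-trans u<v v<w) u≮w
... | no _    | yes _  = m<n⇒m<1+n (countBelow-strict v∈ v<w)
... | no _    | no _   = countBelow-strict v∈ v<w

countBelow-surjective : ∀ {us} → Unique us → ∀ {m} → m < length us →
                        ∃[ v ] (v ∈ us × countBelow v us ≡ m)
countBelow-surjective {a ∷ us} (a∉ ∷ us!) {m} m<len with <-cmp m (countBelow a us)
... | tri≈ _ refl _ = a , here refl , countBelow-∷-≮ (n≮n a)
... | tri< m<k _ _ with countBelow-surjective us! (<-≤-trans m<k (countBelow≤length a us))
...   | v , v∈ , v↦m = v , there v∈ , trans (countBelow-∷-≮ (<-asym v<a)) v↦m
  where
  v<a : v < a
  v<a = ≰⇒> λ a≤v → <-irrefl (sym v↦m) (<-≤-trans m<k (countBelow-mono a≤v us))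
countBelow-surjective {a ∷ us} (a∉ ∷ us!) {suc m} m<len | tri> _ _ k<m
  with countBelow-surjective us! (≤-pred m<len)
... | v , v∈ , v↦m = v , there v∈ , trans (countBelow-∷-< a<v) (cong suc v↦m)
  where
  a<v : a < v
  a<v with <-cmp a v
  ... | tri< a<v _ _  = a<v
  ... | tri≈ _ refl _ = contradiction refl (All.lookup a∉ v∈)
  ... | tri> _ _ v<a  = contradiction (subst (_< countBelow a us) v↦m (countBelow-strict v∈ v<a))
                                      (≤⇒≯ (≤-pred k<m))

-- Standardisation

module Standardisation {ls n C} (dec : Decreasing ls) (size : sum ls ≡ n)
                       (G : IsGenCocharge ls C) (L : LeftmostCondition ls C) where
  open IsGenCocharge G

  column<n : InShape ls r c → c < n
  column<n {r} s = <-≤-trans s (≤-trans (rowLen≤sum ls r) (≤-reflexive size))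

  -- Since columns are < n, comparing keys compares (entry, column) lexicographically.
  key : ℕ → ℕ → ℕ
  key r c = C r c * n + c

  key-<-entry : C r c < C r' c' → c < n → key r c < key r' c'
  key-<-entry {r} {c} {r'} {c'} lt c<n = begin-strict
    C r c * n + c    <⟨ +-monoʳ-< (C r c * n) c<n ⟩
    C r c * n + n    ≡⟨ +-comm (C r c * n) n ⟩
    suc (C r c) * n  ≤⟨ *-monoˡ-≤ n lt ⟩
    C r' c' * n      ≤⟨ m≤m+n (C r' c' * n) c' ⟩
    C r' c' * n + c' ∎
    where open ≤-Reasoning

  key-<-column : C r c ≡ C r' c' → c < c' → key r c < key r' c'
  key-<-column {r} {c} {r'} {c'} same c<c' rewrite same = +-monoʳ-< (C r' c' * n) c<c'

  key-<⇒entry-≤ : key r c < key r' c' → c' < n → C r c ≤ C r' c'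
  key-<⇒entry-≤ k< c'<n = ≮⇒≥ λ gt → <-asym (key-<-entry gt c'<n) k<

  key-<⇒column-< : key r c < key r' c' → C r c ≡ C r' c' → c < c'
  key-<⇒column-< {r} {c} {r'} {c'} k< same rewrite same = +-cancelˡ-< (C r' c' * n) c c' k<

  key-<-right : InShape ls r (suc c) → key r c < key r (suc c)
  key-<-right {r} {c} s with m≤n⇒m<n∨m≡n (rows-weak r c s)
  ... | inj₁ lt   = key-<-entry lt (column<n (<-trans (n<1+n c) s))
  ... | inj₂ same = key-<-column same (n<1+n c)

  key-injective : InShape ls r c → InShape ls r' c' → key r c ≡ key r' c' →
                  r ≡ r' × c ≡ c'
  key-injective {r} {c} {r'} {c'} s s' k≡ with <-cmp (C r c) (C r' c')
  ... | tri< lt _ _ = contradiction k≡ (<⇒≢ (key-<-entry lt (column<n s)))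
  ... | tri> _ _ gt = contradiction k≡ (>⇒≢ (key-<-entry gt (column<n s')))
  ... | tri≈ _ same _ with <-cmp c c'
  ...   | tri< c<c' _ _ = contradiction k≡ (<⇒≢ (key-<-column same c<c'))
  ...   | tri> _ _ c>c' = contradiction k≡ (>⇒≢ (key-<-column (sym same) c>c'))
  ...   | tri≈ _ refl _ with <-cmp r r'
  ...     | tri< r<r' _ _ = contradiction same (<⇒≢ (col-< dec C cols-strict r<r' s'))
  ...     | tri≈ _ r≡r' _ = r≡r' , refl
  ...     | tri> _ _ r>r' = contradiction same (>⇒≢ (col-< dec C cols-strict r>r' s))

  keys : List ℕ
  keys = map (uncurry key) (cells ls)

  keys-unique : Unique keys
  keys-unique = Unique-map⁺-on injective-on-cells (cellsFrom-unique 0 ls)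
    where
    injective-on-cells : ∀ {x y} → x ∈ cells ls → y ∈ cells ls →
                         uncurry key x ≡ uncurry key y → x ≡ y
    injective-on-cells {_ , _} {_ , _} x∈ y∈ k≡ =
      let r≡r' , c≡c' = key-injective (∈-cells⁻ ls x∈) (∈-cells⁻ ls y∈) k≡
      in  cong₂ _,_ r≡r' c≡c'

  length-keys : length keys ≡ n
  length-keys = trans (length-map (uncurry key) (cells ls)) (trans (length-cellsFrom 0 ls) size)

  key∈keys : InShape ls r c → key r c ∈ keys
  key∈keys s = ∈-map⁺ (uncurry key) (∈-cells⁺ ls s)

  rank : ℕ → ℕ → ℕ
  rank r c = countBelow (key r c) keys

  rank-< : InShape ls r c → key r c < key r' c' → rank r c < rank r' c'
  rank-< s = countBelow-strict (key∈keys s)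

  rank-<⁻ : rank r c < rank r' c' → key r c < key r' c'
  rank-<⁻ lt = ≰⇒> λ k≥k' → <⇒≱ lt (countBelow-mono k≥k' keys)

  rank<n : InShape ls r c → rank r c < n
  rank<n {r} {c} s = subst (rank r c <_) length-keys (countBelow-<-length (key∈keys s))

  rank-injective : InShape ls r c → InShape ls r' c' → rank r c ≡ rank r' c' →
                   r ≡ r' × c ≡ c'
  rank-injective {r} {c} {r'} {c'} s s' rank≡ with <-cmp (key r c) (key r' c')
  ... | tri< lt _ _ = contradiction rank≡ (<⇒≢ (rank-< s lt))
  ... | tri≈ _ k≡ _ = key-injective s s' k≡
  ... | tri> _ _ gt = contradiction rank≡ (>⇒≢ (rank-< s' gt))

  rank-surjective : ∀ {m} → m < n → ∃[ r ] ∃[ c ] (InShape ls r c × rank r c ≡ m)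
  rank-surjective m<n
    with countBelow-surjective keys-unique (subst (_ <_) (sym length-keys) m<n)
  ... | _ , k∈ , k↦m with ∈-map⁻ (uncurry key) k∈
  ...   | (r , c) , rc∈ , refl = r , c , ∈-cells⁻ ls rc∈ , k↦m

  S : Filling
  S r c = suc (rank r c)

  S-isSYT : IsSYT ls n S
  S-isSYT = record
    { entry-range = λ r c s → s≤s z≤n , rank<n s
    ; injective   = λ r c r' c' s s' S≡ → rank-injective s s' (suc-injective S≡)
    ; surjective  = λ { (suc m) _ m<n →
                        let r , c , s , rank≡ = rank-surjective m<n in r , c , s , cong suc rank≡ }
    ; rows-incr   = λ r c s → s≤s (rank-< (<-trans (n<1+n c) s) (key-<-right s))
    ; cols-incr   = λ r c s → let s↑ = InShape-up dec (n≤1+n r) s in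
                                s≤s (rank-< s↑ (key-<-entry (cols-strict r c s) (column<n s↑)))
    }

  module Consecutive {r' c' r c} (s' : InShape ls r' c') (s : InShape ls r c)
                     (next : rank r c ≡ suc (rank r' c')) where

    nothing-between : ∀ {r₀ c₀} → InShape ls r₀ c₀ →
                      key r' c' < key r₀ c₀ → key r₀ c₀ < key r c → ⊥
    nothing-between s₀ after before =
      <⇒≱ (rank-< s' after) (≤-pred (subst (_ <_) next (rank-< s₀ before)))

    key-step : key r' c' < key r c
    key-step = rank-<⁻ (subst (rank r' c' <_) (sym next) (n<1+n _))

    entry-≤ : C r' c' ≤ C r c
    entry-≤ = key-<⇒entry-≤ key-step (column<n s)

    tie⇒¬descent : C r' c' ≡ C r c → ¬ Descent (r' , c') (r , c)
    tie⇒¬descent same (r'<r , _) =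
      <⇒≱ r'<r (horizontal-strip dec G s same (<⇒≤ (key-<⇒column-< key-step same)))

    module Jump (jump : C r' c' < C r c) where

      successor : C r c ≡ suc (C r' c')
      successor = ≤-antisym (≮⇒≥ skipped) jump
        where
        skipped : suc (C r' c') < C r c → ⊥
        skipped gap with values
        ... | k , below , occurs with occurs (suc (C r' c')) (<-trans gap (below r c s))
        ... | r₀ , c₀ , s₀ , C₀≡ = nothing-between s₀
          (key-<-entry (subst (C r' c' <_) (sym C₀≡) (n<1+n _)) (column<n s'))
          (key-<-entry (subst (_< C r c) (sym C₀≡) gap) (column<n s₀))

      leftmost : ∀ r₀ c₀ → InShape ls r₀ c₀ → C r₀ c₀ ≡ C r c → c ≤ c₀
      leftmost r₀ c₀ s₀ same = ≮⇒≥ λ c₀<c → nothing-between s₀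
        (key-<-entry (subst (C r' c' <_) (sym same) jump) (column<n s'))
        (key-<-column same c₀<c)

      rightmost : ∀ r₀ c₀ → InShape ls r₀ c₀ → C r₀ c₀ ≡ C r' c' → c₀ ≤ c'
      rightmost r₀ c₀ s₀ same = ≮⇒≥ λ c'<c₀ → nothing-between s₀
        (key-<-column (sym same) c'<c₀)
        (key-<-entry (subst (_< C r c) (sym same) jump) (column<n s₀))

      higher-row : r' < r
      higher-row with L (C r c) r c (≤-<-trans z≤n jump) s refl leftmost
      ... | r₀ , c₀ , r₀<r , s₀ , C₀≡ =
        ≤-<-trans (horizontal-strip dec G s' same (rightmost r₀ c₀ s₀ same)) r₀<r
        where
        same : C r₀ c₀ ≡ C r' c'
        same = trans C₀≡ (cong (_∸ 1) successor)

      descent : Descent (r' , c') (r , c)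
      descent = higher-row , ≮⇒≥ λ c'<c →
        let s↑    = InShape-up dec (<⇒≤ higher-row) s
            above = subst (C r' c <_) successor (col-< dec C cols-strict higher-row s)
            same  = ≤-antisym (≤-pred above) (row-≤ dec C rows-weak (<⇒≤ c'<c) s↑)
        in  <⇒≱ c'<c (rightmost r' c s↑ same)

    ct≡C-step : ct ls S r' c' ≡ C r' c' → ct ls S r c ≡ C r c
    ct≡C-step ih with m≤n⇒m<n∨m≡n entry-≤
    ... | inj₂ tie = begin
      ct ls S r c    ≡⟨ ct-step-ascent S-isSYT s' s (cong suc next) (tie⇒¬descent tie) ⟩
      ct ls S r' c'  ≡⟨ ih ⟩
      C r' c'        ≡⟨ tie ⟩
      C r c          ∎
      where open ≡-Reasoning
    ... | inj₁ jump = begin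
      ct ls S r c         ≡⟨ ct-step-descent S-isSYT s' s (cong suc next) descent ⟩
      suc (ct ls S r' c') ≡⟨ cong suc ih ⟩
      suc (C r' c')       ≡⟨ sym successor ⟩
      C r c               ∎
      where
      open ≡-Reasoning
      open Jump jump

  rank-zero⇒entry-zero : InShape ls r c → rank r c ≡ 0 → C r c ≡ 0
  rank-zero⇒entry-zero {r} {c} s rank≡0 with values
  ... | k , below , occurs with occurs 0 (≤-<-trans z≤n (below r c s))
  ... | r₀ , c₀ , s₀ , C₀≡0 = n≤0⇒n≡0 (≮⇒≥ λ 0<C →
    n≮0 (subst (rank r₀ c₀ <_) rank≡0
          (rank-< s₀ (key-<-entry (subst (_< C r c) (sym C₀≡0) 0<C) (column<n s₀)))))

  ct≡C-by-rank : ∀ m → InShape ls r c → rank r c ≡ m → ct ls S r c ≡ C r c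
  ct≡C-by-rank zero    s rank≡0 =
    trans (ct-at ls S (cong suc rank≡0)) (sym (rank-zero⇒entry-zero s rank≡0))
  ct≡C-by-rank (suc m) s rank≡
    with rank-surjective (<-trans (n<1+n m) (subst (_< n) rank≡ (rank<n s)))
  ... | r' , c' , s' , rank'≡ =
    Consecutive.ct≡C-step s' s (trans rank≡ (cong suc (sym rank'≡))) (ct≡C-by-rank m s' rank'≡)

  standardisation : ∃[ S ] (IsSYT ls n S × C ≐[ ls ] ct ls S)
  standardisation = S , S-isSYT , λ r c s → sym (ct≡C-by-rank _ s refl)

lemma1p15 : (λs : List ℕ) (n : ℕ) → λs ⊢ n → (C : Filling) → IsGenCocharge λs C →
    ((∃[ S ] (IsSYT λs n S × C ≐[ λs ] ct λs S)) → LeftmostCondition λs C)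
    × (LeftmostCondition λs C → ∃[ S ] (IsSYT λs n S × C ≐[ λs ] ct λs S))
    × (LeftmostCondition λs C → NonzeroOffFirstRow λs C)
lemma1p15 λs n (dec , _ , size) C G =
  (λ (S , syt , C≐ct) → leftmost-cong {λs} C≐ct (ct-leftmost syt dec)) ,
  (λ L → Standardisation.standardisation dec size G L) ,
  leftmost⇒nonzero-off-first-row {λs}
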